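{- Let $D$ be the shadow, on the $2$-sphere $S^2$, of the standard $3$-crossing (minimal crossing) diagram of the trefoil knot. Then for every connected smoothed state of $D$ taken as the starting game board, if Player C moves first in the Region Smoothing Swap Game, Player C has a winning strategy.
   Context: A link shadow is a link diagram on a closed surface $S$ with over/under information omitted at its crossings (called precrossings); it is assumed connected, and the components of the complement of the shadow in $S$ are called regions. Each precrossing can be smoothed in one of two ways (replacing the crossing by two non-crossing arcs). A choice of smoothing at every precrossing is a smoothed state; it is a collection of disjoint simple closed curves on $S$, and is called connected if it consists of exactly one closed curve. A region smoothing swap at a region $r$ replaces the smoothing at every precrossing on the boundary of $r$ by the other smoothing. The Region Smoothing Swap Game: start from a connected smoothed state (the game board). Two players, C and D, alternate turns; on a turn the player selects a region not selected before and either performs the region smoothing swap at it or leaves the state unchanged. The game ends when every region has been selected exactly once. Player C wins if the final smoothed state is connected; otherwise Player D wins. -}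

module Defs where

open import Data.Nat using (ℕ; zero; suc)
open import Data.Fin using (Fin; zero; suc)
open import Data.Bool using (Bool; true; false; not; if_then_else_)
open import Data.Product using (Σ; _×_; _,_; proj₁; ∃)
open import Data.Fin.Subset using (Subset; _∉_; _∪_; ⁅_⁆; ⊥)
open import Function using (_∘_)
open import Relation.Binary.PropositionalEquality using (_≡_)

-- Crossings (precrossings) x₀, x₁, x₂ : Fin 3.
-- The closed curve passes x₀,x₁,x₂,x₀,x₁,x₂; it is cut into 6 edges
-- e₀..e₅, edge eᵢ running from crossing (i mod 3) to crossing (i+1 mod 3).
-- A half-edge (edge end) is (e , true) = start of e, (e , false) = end of e.
-- At crossing xⱼ the four ends are: ends of e_{j+5}, e_{j+2}; starts of
-- e_j, e_{j+3}; the strands are e_{j+5}→e_j and e_{j+2}→e_{j+3}.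
-- The two smoothings at xⱼ are
--   seifert    : e_{j+5}-end ↔ e_{j+3}-start ,  e_{j+2}-end ↔ e_j-start
--   nonSeifert : e_{j+5}-end ↔ e_{j+2}-end   ,  e_j-start   ↔ e_{j+3}-start
-- (these are the only two pairings of adjacent ends at a transverse
-- crossing, independently of the crossing's orientation).
--
-- Regions (F = 2 - V + E = 5):
--   r₀ = central region, r₁ = outer region (each bounded by all three
--   precrossings), r₂, r₃, r₄ = the three lobes, bounded by {x₀,x₁},
--   {x₁,x₂}, {x₂,x₀} respectively.

Crossing : Set
Crossing = Fin 3

Edge : Set
Edge = Fin 6

Region : Set
Region = Fin 5

HalfEdge : Set
HalfEdge = Edge × Bool

data Smoothing : Set where
  seifert nonSeifert : Smoothing

otherSmoothing : Smoothing → Smoothing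
otherSmoothing seifert    = nonSeifert
otherSmoothing nonSeifert = seifert

State : Set
State = Crossing → Smoothing

otherEnd : HalfEdge → HalfEdge
otherEnd (e , b) = (e , not b)

e0 e1 e2 e3 e4 e5 : Edge
e0 = zero
e1 = suc zero
e2 = suc (suc zero)
e3 = suc (suc (suc zero))
e4 = suc (suc (suc (suc zero)))
e5 = suc (suc (suc (suc (suc zero))))

x0 x1 x2 : Crossing
x0 = zero
x1 = suc zero
x2 = suc (suc zero)

st en : Bool
st = true
en = false

partnerS : HalfEdge → HalfEdge
partnerS (zero , false)                               = (e4 , st)
partnerS (zero , true)                                = (e2 , en)
partnerS (suc zero , false)                           = (e5 , st)
partnerS (suc zero , true)                            = (e3 , en)
partnerS (suc (suc zero) , false)                     = (e0 , st)
partnerS (suc (suc zero) , true)                      = (e4 , en)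
partnerS (suc (suc (suc zero)) , false)               = (e1 , st)
partnerS (suc (suc (suc zero)) , true)                = (e5 , en)
partnerS (suc (suc (suc (suc zero))) , false)         = (e2 , st)
partnerS (suc (suc (suc (suc zero))) , true)          = (e0 , en)
partnerS (suc (suc (suc (suc (suc zero)))) , false)   = (e3 , st)
partnerS (suc (suc (suc (suc (suc zero)))) , true)    = (e1 , en)

partnerN : HalfEdge → HalfEdge
partnerN (zero , false)                               = (e3 , en)
partnerN (zero , true)                                = (e3 , st)
partnerN (suc zero , false)                           = (e4 , en)
partnerN (suc zero , true)                            = (e4 , st)
partnerN (suc (suc zero) , false)                     = (e5 , en)
partnerN (suc (suc zero) , true)                      = (e5 , st)
partnerN (suc (suc (suc zero)) , false)               = (e0 , en)
partnerN (suc (suc (suc zero)) , true)                = (e0 , st)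
partnerN (suc (suc (suc (suc zero))) , false)         = (e1 , en)
partnerN (suc (suc (suc (suc zero))) , true)          = (e1 , st)
partnerN (suc (suc (suc (suc (suc zero)))) , false)   = (e2 , en)
partnerN (suc (suc (suc (suc (suc zero)))) , true)    = (e2 , st)

crossingAt : HalfEdge → Crossing
crossingAt (zero , true)                              = x0
crossingAt (zero , false)                             = x1
crossingAt (suc zero , true)                          = x1
crossingAt (suc zero , false)                         = x2
crossingAt (suc (suc zero) , true)                    = x2
crossingAt (suc (suc zero) , false)                   = x0
crossingAt (suc (suc (suc zero)) , true)              = x0
crossingAt (suc (suc (suc zero)) , false)             = x1
crossingAt (suc (suc (suc (suc zero))) , true)        = x1
crossingAt (suc (suc (suc (suc zero))) , false)       = x2
crossingAt (suc (suc (suc (suc (suc zero)))) , true)  = x2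
crossingAt (suc (suc (suc (suc (suc zero)))) , false) = x0

partner : State → HalfEdge → HalfEdge
partner s h with s (crossingAt h)
... | seifert    = partnerS h
... | nonSeifert = partnerN h

step : State → HalfEdge → HalfEdge
step s = partner s ∘ otherEnd

iterate : {A : Set} → (A → A) → ℕ → A → A
iterate f zero    a = a
iterate f (suc k) a = f (iterate f k a)

-- The state curves partition the edges of D.  The smoothed state is
-- connected (exactly one closed curve) iff every edge lies on the state
-- curve through edge e₀.
Connected : State → Set
Connected s = (e : Edge) → ∃ λ k → proj₁ (iterate (step s) k (e0 , st)) ≡ e

onBoundary : Region → Crossing → Bool
onBoundary zero                      _                = true
onBoundary (suc zero)                _                = true
onBoundary (suc (suc zero))          zero             = true
onBoundary (suc (suc zero))          (suc zero)       = true
onBoundary (suc (suc zero))          (suc (suc zero)) = false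
onBoundary (suc (suc (suc zero)))    zero             = false
onBoundary (suc (suc (suc zero)))    (suc zero)       = true
onBoundary (suc (suc (suc zero)))    (suc (suc zero)) = true
onBoundary (suc (suc (suc (suc zero)))) zero             = true
onBoundary (suc (suc (suc (suc zero)))) (suc zero)       = false
onBoundary (suc (suc (suc (suc zero)))) (suc (suc zero)) = true

regionSwap : Region → State → State
regionSwap r s x = if onBoundary r x then otherSmoothing (s x) else s x

move : Bool → Region → State → State
move true  r s = regionSwap r s
move false r s = s

data Player : Set where
  playerC playerD : Player

-- CWins n p used s : in the position with state s, set `used` of already
-- selected regions, n regions still unselected, and player p to move,
-- Player C has a winning strategy.
CWins : ℕ → Player → Subset 5 → State → Set
CWins zero    _       _    s = Connected s
CWins (suc n) playerC used s =
  Σ Region λ r → r ∉ used × Σ Bool λ b → CWins n playerD (used ∪ ⁅ r ⁆) (move b r s)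
CWins (suc n) playerD used s =
  (r : Region) → r ∉ used → (b : Bool) → CWins n playerC (used ∪ ⁅ r ⁆) (move b r s)

noneSelected : Subset 5
noneSelected = ⊥

-- A smoothed state of the trefoil shadow is connected exactly when one of
-- its three precrossings carries the non-Seifert smoothing.  The central
-- and outer regions both swap all three precrossings, so one of them
-- undoes the other; and after a swap at one lobe, a suitable choice at a
-- second lobe restores exactly one non-Seifert precrossing.  Player C
-- therefore opens by passing at the lobe {x₀,x₁} and afterwards answers
-- each of D's moves in the pairs {central, outer} and {lobe {x₁,x₂},
-- lobe {x₂,x₀}} with the partner region, so that after each of C's moves
-- the state has exactly one non-Seifert precrossing.
module Submission where

open import Defs
open import Data.Nat using (ℕ; zero; suc; _+_; _*_; _<_; NonZero)
open import Data.Nat.Properties using (anyUpTo?)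
open import Data.Nat.DivMod using (_%_; _/_; m≡m%n+[m/n]*n; m%n<n)
open import Data.Fin using (Fin; zero; suc)
open import Data.Fin.Properties using (all?; _≟_)
open import Data.Fin.Subset using (Subset; _∈_; _∉_; _∪_; ⁅_⁆)
open import Data.Fin.Subset.Properties using (_∈?_)
open import Data.Bool using (true; false; if_then_else_)
open import Data.Product using (_×_; _,_; proj₁; ∃)
open import Data.Empty using (⊥-elim)
open import Function using (_∘_)
open import Relation.Nullary.Decidable using (Dec; map′; from-yes; from-no; True; False; toWitness; toWitnessFalse)
open import Relation.Binary.PropositionalEquality using (_≡_; _≗_; refl; sym; trans; cong; module ≡-Reasoning)

iterate-+ : {A : Set} (f : A → A) (m n : ℕ) (x : A) →
            iterate f (m + n) x ≡ iterate f m (iterate f n x)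
iterate-+ f zero    n x = refl
iterate-+ f (suc m) n x = cong f (iterate-+ f m n x)

iterate-*-periodic : {A : Set} (f : A → A) (n : ℕ) {x : A} →
                     iterate f n x ≡ x → ∀ q → iterate f (q * n) x ≡ x
iterate-*-periodic f n p zero    = refl
iterate-*-periodic f n {x} p (suc q) = begin
  iterate f (n + q * n) x           ≡⟨ iterate-+ f n (q * n) x ⟩
  iterate f n (iterate f (q * n) x) ≡⟨ cong (iterate f n) (iterate-*-periodic f n p q) ⟩
  iterate f n x                     ≡⟨ p ⟩
  x                                 ∎
  where open ≡-Reasoning

iterate-%-periodic : {A : Set} (f : A → A) (n : ℕ) .{{_ : NonZero n}} {x : A} →
                     iterate f n x ≡ x → ∀ k → iterate f k x ≡ iterate f (k % n) x
iterate-%-periodic f n {x} p k = begin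
  iterate f k x                               ≡⟨ cong (λ m → iterate f m x) (m≡m%n+[m/n]*n k n) ⟩
  iterate f (k % n + k / n * n) x             ≡⟨ iterate-+ f (k % n) (k / n * n) x ⟩
  iterate f (k % n) (iterate f (k / n * n) x) ≡⟨ cong (iterate f (k % n)) (iterate-*-periodic f n p (k / n)) ⟩
  iterate f (k % n) x                         ∎
  where open ≡-Reasoning

h₀ : HalfEdge
h₀ = (e0 , st)

partner-cong : ∀ {s t} → s ≗ t → partner s ≗ partner t
partner-cong {s} {t} s≗t h with s (crossingAt h) | t (crossingAt h) | s≗t (crossingAt h)
... | seifert    | _ | refl = refl
... | nonSeifert | _ | refl = refl

iterate-step-cong : ∀ {s t} → s ≗ t → ∀ k → iterate (step s) k ≗ iterate (step t) k
iterate-step-cong s≗t zero    h = refl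
iterate-step-cong {s} {t} s≗t (suc k) h =
  trans (cong (step s) (iterate-step-cong s≗t k h)) (partner-cong {s} {t} s≗t _)

Connected-resp-≗ : ∀ {s t} → s ≗ t → Connected s → Connected t
Connected-resp-≗ s≗t c e with c e
... | k , eq = k , trans (cong proj₁ (sym (iterate-step-cong s≗t k h₀))) eq

CoveredWithin : ℕ → State → Set
CoveredWithin n s = (e : Edge) → ∃ λ i → i < n × proj₁ (iterate (step s) i h₀) ≡ e

covered⇒connected : ∀ {n s} → CoveredWithin n s → Connected s
covered⇒connected cov e with cov e
... | i , _ , eq = i , eq

connected⇒covered : ∀ {n s} .{{_ : NonZero n}} → iterate (step s) n h₀ ≡ h₀ →
                    Connected s → CoveredWithin n s
connected⇒covered {n} {s} period c e with c e
... | k , eq =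
  k % n , m%n<n k n , trans (cong proj₁ (sym (iterate-%-periodic (step s) n period k))) eq

connected-dec : ∀ n s .{{_ : NonZero n}} → iterate (step s) n h₀ ≡ h₀ → Dec (Connected s)
connected-dec n s period =
  map′ (covered⇒connected {n} {s}) (connected⇒covered {n} {s} period)
       (all? λ e → anyUpTo? (λ i → proj₁ (iterate (step s) i h₀) ≟ e) n)

state : Smoothing → Smoothing → Smoothing → State
state a b c zero             = a
state a b c (suc zero)       = b
state a b c (suc (suc zero)) = c

state-η : ∀ s → s ≗ state (s x0) (s x1) (s x2)
state-η s zero             = refl
state-η s (suc zero)       = refl
state-η s (suc (suc zero)) = refl

-- Every state curve of the trefoil shadow has 2, 3, 4 or 6 edges, so 12 is a common period.
state-period : ∀ a b c → iterate (step (state a b c)) 12 h₀ ≡ h₀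
state-period seifert    seifert    seifert    = refl
state-period seifert    seifert    nonSeifert = refl
state-period seifert    nonSeifert seifert    = refl
state-period seifert    nonSeifert nonSeifert = refl
state-period nonSeifert seifert    seifert    = refl
state-period nonSeifert seifert    nonSeifert = refl
state-period nonSeifert nonSeifert seifert    = refl
state-period nonSeifert nonSeifert nonSeifert = refl

connected-state? : ∀ a b c → Dec (Connected (state a b c))
connected-state? a b c = connected-dec 12 (state a b c) (state-period a b c)

data ExactlyOneNonSeifert : Smoothing → Smoothing → Smoothing → Set where
  only₀ : ExactlyOneNonSeifert nonSeifert seifert seifert
  only₁ : ExactlyOneNonSeifert seifert nonSeifert seifert
  only₂ : ExactlyOneNonSeifert seifert seifert nonSeifert

exactlyOne⇒connected : ∀ {a b c} → ExactlyOneNonSeifert a b c → Connected (state a b c)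
exactlyOne⇒connected only₀ = from-yes (connected-state? nonSeifert seifert seifert)
exactlyOne⇒connected only₁ = from-yes (connected-state? seifert nonSeifert seifert)
exactlyOne⇒connected only₂ = from-yes (connected-state? seifert seifert nonSeifert)

connected⇒exactlyOne : ∀ a b c → Connected (state a b c) → ExactlyOneNonSeifert a b c
connected⇒exactlyOne nonSeifert seifert    seifert    _ = only₀
connected⇒exactlyOne seifert    nonSeifert seifert    _ = only₁
connected⇒exactlyOne seifert    seifert    nonSeifert _ = only₂
connected⇒exactlyOne seifert    seifert    seifert =
  ⊥-elim ∘ from-no (connected-state? seifert seifert seifert)
connected⇒exactlyOne seifert    nonSeifert nonSeifert =
  ⊥-elim ∘ from-no (connected-state? seifert nonSeifert nonSeifert)
connected⇒exactlyOne nonSeifert seifert    nonSeifert =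
  ⊥-elim ∘ from-no (connected-state? nonSeifert seifert nonSeifert)
connected⇒exactlyOne nonSeifert nonSeifert seifert =
  ⊥-elim ∘ from-no (connected-state? nonSeifert nonSeifert seifert)
connected⇒exactlyOne nonSeifert nonSeifert nonSeifert =
  ⊥-elim ∘ from-no (connected-state? nonSeifert nonSeifert nonSeifert)

OneNonSeifert : State → Set
OneNonSeifert s = ExactlyOneNonSeifert (s x0) (s x1) (s x2)

OneNonSeifert-resp-≗ : ∀ {s t} → s ≗ t → OneNonSeifert s → OneNonSeifert t
OneNonSeifert-resp-≗ {s} {t} s≗t one rewrite sym (s≗t x0) | sym (s≗t x1) | sym (s≗t x2) = one

oneNonSeifert⇒connected : ∀ s → OneNonSeifert s → Connected s
oneNonSeifert⇒connected s one = Connected-resp-≗ (sym ∘ state-η s) (exactlyOne⇒connected one)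

connected⇒oneNonSeifert : ∀ s → Connected s → OneNonSeifert s
connected⇒oneNonSeifert s c = connected⇒exactlyOne _ _ _ (Connected-resp-≗ (state-η s) c)

pattern central = zero
pattern outer   = suc zero
pattern lobe₀₁  = suc (suc zero)
pattern lobe₁₂  = suc (suc (suc zero))
pattern lobe₂₀  = suc (suc (suc (suc zero)))

otherSmoothing-involutive : ∀ m → otherSmoothing (otherSmoothing m) ≡ m
otherSmoothing-involutive seifert    = refl
otherSmoothing-involutive nonSeifert = refl

move-cancel : ∀ b {r r'} → onBoundary r ≗ onBoundary r' → ∀ s → move b r' (move b r s) ≗ s
move-cancel false _     s x = refl
move-cancel true  {r} {r'} same s x rewrite sym (same x) with onBoundary r x
... | true  = otherSmoothing-involutive (s x)
... | false = refl

move-cancel-preserves-one : ∀ b {r r'} → onBoundary r ≗ onBoundary r' →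
                            ∀ s → OneNonSeifert s → OneNonSeifert (move b r' (move b r s))
move-cancel-preserves-one b same s = OneNonSeifert-resp-≗ (sym ∘ move-cancel b same s)

move-cong : ∀ b r {s t} → s ≗ t → move b r s ≗ move b r t
move-cong false r s≗t x = s≗t x
move-cong true  r s≗t x = cong (λ m → if onBoundary r x then otherSmoothing m else m) (s≗t x)

lobe₁₂-lobe₂₀-restore : ∀ b s → OneNonSeifert s →
                        ∃ λ b' → OneNonSeifert (move b' lobe₂₀ (move b lobe₁₂ s))
lobe₁₂-lobe₂₀-restore b s one =
  let b' , one' = restore b one
  in b' , OneNonSeifert-resp-≗ (move-cong b' lobe₂₀ (move-cong b lobe₁₂ (sym ∘ state-η s))) one'
  where
  restore : ∀ b {x y z} → ExactlyOneNonSeifert x y z →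
            ∃ λ b' → OneNonSeifert (move b' lobe₂₀ (move b lobe₁₂ (state x y z)))
  restore false one   = false , one
  restore true  only₀ = true  , only₁
  restore true  only₁ = false , only₂
  restore true  only₂ = false , only₁

lobe₂₀-lobe₁₂-restore : ∀ b s → OneNonSeifert s →
                        ∃ λ b' → OneNonSeifert (move b' lobe₁₂ (move b lobe₂₀ s))
lobe₂₀-lobe₁₂-restore b s one =
  let b' , one' = restore b one
  in b' , OneNonSeifert-resp-≗ (move-cong b' lobe₁₂ (move-cong b lobe₂₀ (sym ∘ state-η s))) one'
  where
  restore : ∀ b {x y z} → ExactlyOneNonSeifert x y z →
            ∃ λ b' → OneNonSeifert (move b' lobe₁₂ (move b lobe₂₀ (state x y z)))
  restore false one   = false , one
  restore true  only₀ = false , only₂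
  restore true  only₁ = true  , only₀
  restore true  only₂ = false , only₀

unselected : ∀ {n} {r : Fin n} {u : Subset n} {p : False (r ∈? u)} → r ∉ u
unselected {p = p} = toWitnessFalse p

selected : ∀ {n} {r : Fin n} {u : Subset n} {p : True (r ∈? u)} → r ∈ u
selected {p = p} = toWitness p

endgame-central-outer : ∀ s → OneNonSeifert s →
                        CWins 2 playerD (⁅ lobe₀₁ ⁆ ∪ ⁅ lobe₁₂ ⁆ ∪ ⁅ lobe₂₀ ⁆) s
endgame-central-outer s one central _ b =
  outer , unselected , b ,
  oneNonSeifert⇒connected (move b outer (move b central s)) (move-cancel-preserves-one b (λ _ → refl) s one)
endgame-central-outer s one outer _ b =
  central , unselected , b ,
  oneNonSeifert⇒connected (move b central (move b outer s)) (move-cancel-preserves-one b (λ _ → refl) s one)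
endgame-central-outer s one lobe₀₁ r∉u b = ⊥-elim (r∉u selected)
endgame-central-outer s one lobe₁₂ r∉u b = ⊥-elim (r∉u selected)
endgame-central-outer s one lobe₂₀ r∉u b = ⊥-elim (r∉u selected)

endgame-lobes : ∀ s → OneNonSeifert s →
                CWins 2 playerD (⁅ central ⁆ ∪ ⁅ outer ⁆ ∪ ⁅ lobe₀₁ ⁆) s
endgame-lobes s one central r∉u b = ⊥-elim (r∉u selected)
endgame-lobes s one outer   r∉u b = ⊥-elim (r∉u selected)
endgame-lobes s one lobe₀₁  r∉u b = ⊥-elim (r∉u selected)
endgame-lobes s one lobe₁₂ _ b with lobe₁₂-lobe₂₀-restore b s one
... | b' , one' =
  lobe₂₀ , unselected , b' , oneNonSeifert⇒connected (move b' lobe₂₀ (move b lobe₁₂ s)) one'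
endgame-lobes s one lobe₂₀ _ b with lobe₂₀-lobe₁₂-restore b s one
... | b' , one' =
  lobe₁₂ , unselected , b' , oneNonSeifert⇒connected (move b' lobe₁₂ (move b lobe₂₀ s)) one'

after-passing-at-lobe₀₁ : ∀ s → OneNonSeifert s → CWins 4 playerD ⁅ lobe₀₁ ⁆ s
after-passing-at-lobe₀₁ s one central _ b =
  outer , unselected , b ,
  endgame-lobes (move b outer (move b central s)) (move-cancel-preserves-one b (λ _ → refl) s one)
after-passing-at-lobe₀₁ s one outer _ b =
  central , unselected , b ,
  endgame-lobes (move b central (move b outer s)) (move-cancel-preserves-one b (λ _ → refl) s one)
after-passing-at-lobe₀₁ s one lobe₀₁ r∉u b = ⊥-elim (r∉u selected)
after-passing-at-lobe₀₁ s one lobe₁₂ _ b with lobe₁₂-lobe₂₀-restore b s one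
... | b' , one' =
  lobe₂₀ , unselected , b' , endgame-central-outer (move b' lobe₂₀ (move b lobe₁₂ s)) one'
after-passing-at-lobe₀₁ s one lobe₂₀ _ b with lobe₂₀-lobe₁₂-restore b s one
... | b' , one' =
  lobe₁₂ , unselected , b' , endgame-central-outer (move b' lobe₁₂ (move b lobe₂₀ s)) one'

mainTheorem3 : (s : State) → Connected s → CWins 5 playerC noneSelected s
mainTheorem3 s c =
  lobe₀₁ , unselected , false , after-passing-at-lobe₀₁ s (connected⇒oneNonSeifert s c)
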